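{- For every set $\Gamma$ of infons and every infon $\varphi$ of $\mathbf{P}[\bot_w]$: $\Gamma\vdash\varphi$ in $\mathbf{P}[\bot_w]$ if and only if $\Gamma^*\vdash\varphi^*$ in $\mathbf{P}[\vee^+]$, where the translation $*$ is defined by $q^*=q$ for $q\in At\cup\{\top,\bot\}$, $(\varphi\wedge\psi)^*=\varphi^*\wedge\psi^*$, $(\varphi\to\psi)^*=(\bot\vee^+\varphi^*)\to\psi^*$, and $\Gamma^*=\{\psi^*:\psi\in\Gamma\}$.
   Context: Fix a set $At$ of atomic infons. Infons of $\mathbf{P}[\bot_w]$ are generated by $\varphi ::= \top\mid\bot \mid At \mid (\varphi\wedge\varphi)\mid(\varphi\to\varphi)$. In $\mathbf{P}[\bot_w]$, $\Gamma\vdash\varphi$ iff there is a finite sequence ending in $\varphi$ whose members are in $\Gamma\cup\{\top\}$ or follow from earlier members by the rules: from $\varphi_1,\varphi_2$ infer $\varphi_1\wedge\varphi_2$; from $\varphi_1\wedge\varphi_2$ infer $\varphi_i$ ($i=1,2$); from $\varphi_2$ infer $\varphi_1\to\varphi_2$ (any $\varphi_1$); from $\varphi_1$ and $\varphi_1\to\varphi_2$ infer $\varphi_2$; from $\bot$ and $\varphi\to\psi$ infer $\psi$. $\mathbf{P}[\vee^+]$ (primal disjunction): formulas are generated by $\varphi ::= \top\mid\bot \mid At \mid (\varphi\wedge\varphi)\mid(\varphi\to\varphi)\mid(\varphi\vee^+\varphi)$, where $\bot$ is an ordinary atom with no special rule. $\Gamma\vdash\varphi$ in $\mathbf{P}[\vee^+]$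 iff there is a finite sequence ending in $\varphi$ whose members are in $\Gamma\cup\{\top\}$ or follow from earlier members by the rules: from $\varphi_1,\varphi_2$ infer $\varphi_1\wedge\varphi_2$; from $\varphi_1\wedge\varphi_2$ infer $\varphi_i$; from $\varphi_2$ infer $\varphi_1\to\varphi_2$; from $\varphi_1$ and $\varphi_1\to\varphi_2$ infer $\varphi_2$; from $\varphi_i$ infer $\varphi_1\vee^+\varphi_2$ ($i=1,2$, any other disjunct). There is no elimination rule for $\vee^+$. -}

module Defs where

open import Level using (Level; _⊔_) renaming (suc to lsuc)
open import Data.List using (List; []; _∷_)
open import Data.List.Membership.Propositional using (_∈_)
open import Data.Product using (∃; _×_)
open import Relation.Binary.PropositionalEquality using (_≡_)

-- Derivations are written as lists in REVERSE order: the head is the last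
-- member of the sequence, the tail is the list of earlier members.

module PBotW {a : Level} (At : Set a) where

  infixr 6 _∧_
  infixr 5 _⇒_

  data Infon : Set a where
    ⊤ : Infon
    ⊥ : Infon
    atom : At → Infon
    _∧_ : Infon → Infon → Infon
    _⇒_ : Infon → Infon → Infon

  data Step {ℓ : Level} (Γ : Infon → Set ℓ) (ps : List Infon) : Infon → Set (a ⊔ ℓ) where
    hyp  : ∀ {φ} → Γ φ → Step Γ ps φ
    top  : Step Γ ps ⊤
    ∧i   : ∀ {φ₁ φ₂} → φ₁ ∈ ps → φ₂ ∈ ps → Step Γ ps (φ₁ ∧ φ₂)
    ∧e₁  : ∀ {φ₁ φ₂} → (φ₁ ∧ φ₂) ∈ ps → Step Γ ps φ₁
    ∧e₂  : ∀ {φ₁ φ₂} → (φ₁ ∧ φ₂) ∈ ps → Step Γ ps φ₂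
    ⇒i   : ∀ {φ₁ φ₂} → φ₂ ∈ ps → Step Γ ps (φ₁ ⇒ φ₂)
    ⇒e   : ∀ {φ₁ φ₂} → φ₁ ∈ ps → (φ₁ ⇒ φ₂) ∈ ps → Step Γ ps φ₂
    ⊥w   : ∀ {φ ψ} → ⊥ ∈ ps → (φ ⇒ ψ) ∈ ps → Step Γ ps ψ

  data Valid {ℓ : Level} (Γ : Infon → Set ℓ) : List Infon → Set (a ⊔ ℓ) where
    []  : Valid Γ []
    _∷_ : ∀ {φ ps} → Step Γ ps φ → Valid Γ ps → Valid Γ (φ ∷ ps)

  _⊢_ : {ℓ : Level} → (Infon → Set ℓ) → Infon → Set (a ⊔ ℓ)
  Γ ⊢ φ = ∃ λ ps → Valid Γ (φ ∷ ps)

module PVee {a : Level} (At : Set a) where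

  infixr 6 _∧_
  infixr 5 _⇒_
  infixr 6 _∨⁺_

  data Formula : Set a where
    ⊤ : Formula
    ⊥ : Formula
    atom : At → Formula
    _∧_ : Formula → Formula → Formula
    _⇒_ : Formula → Formula → Formula
    _∨⁺_ : Formula → Formula → Formula

  data Step {ℓ : Level} (Γ : Formula → Set ℓ) (ps : List Formula) : Formula → Set (a ⊔ ℓ) where
    hyp  : ∀ {φ} → Γ φ → Step Γ ps φ
    top  : Step Γ ps ⊤
    ∧i   : ∀ {φ₁ φ₂} → φ₁ ∈ ps → φ₂ ∈ ps → Step Γ ps (φ₁ ∧ φ₂)
    ∧e₁  : ∀ {φ₁ φ₂} → (φ₁ ∧ φ₂) ∈ ps → Step Γ ps φ₁
    ∧e₂  : ∀ {φ₁ φ₂} → (φ₁ ∧ φ₂) ∈ ps → Step Γ ps φ₂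
    ⇒i   : ∀ {φ₁ φ₂} → φ₂ ∈ ps → Step Γ ps (φ₁ ⇒ φ₂)
    ⇒e   : ∀ {φ₁ φ₂} → φ₁ ∈ ps → (φ₁ ⇒ φ₂) ∈ ps → Step Γ ps φ₂
    ∨i₁  : ∀ {φ₁ φ₂} → φ₁ ∈ ps → Step Γ ps (φ₁ ∨⁺ φ₂)
    ∨i₂  : ∀ {φ₁ φ₂} → φ₂ ∈ ps → Step Γ ps (φ₁ ∨⁺ φ₂)

  data Valid {ℓ : Level} (Γ : Formula → Set ℓ) : List Formula → Set (a ⊔ ℓ) where
    []  : Valid Γ []
    _∷_ : ∀ {φ ps} → Step Γ ps φ → Valid Γ ps → Valid Γ (φ ∷ ps)

  _⊢_ : {ℓ : Level} → (Formula → Set ℓ) → Formula → Set (a ⊔ ℓ)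
  Γ ⊢ φ = ∃ λ ps → Valid Γ (φ ∷ ps)

module Translation {a : Level} (At : Set a) where
  open PBotW At
  open PVee At renaming (⊤ to ⊤⁺; ⊥ to ⊥⁺; atom to atom⁺; _∧_ to _∧⁺_; _⇒_ to _⇒⁺_)

  _* : Infon → Formula
  ⊤ * = ⊤⁺
  ⊥ * = ⊥⁺
  atom q * = atom⁺ q
  (φ ∧ ψ) * = (φ *) ∧⁺ (ψ *)
  (φ ⇒ ψ) * = (⊥⁺ ∨⁺ (φ *)) ⇒⁺ (ψ *)

  _*ˢ : {ℓ : Level} → (Infon → Set ℓ) → Formula → Set (a ⊔ ℓ)
  (Γ *ˢ) χ = ∃ λ ψ → Γ ψ × (ψ *) ≡ χ

-- Each rule of P[⊥w] is simulated by a short derivation in P[∨⁺]: ⇒e and ⊥w both become an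
-- ∨⁺-introduction into the antecedent ⊥ ∨⁺ φ* followed by modus ponens.
-- Conversely, as ∨⁺ has no elimination rule, every formula derivable from Γ* is realized:
-- ⊥ and atoms by their P[⊥w]-derivability, ∧ and ∨⁺ by pairs and tagged realizers, and an
-- implication by a map on realizers together with P[⊥w]-derivability of its preimage under *.
-- By induction on φ, φ* is realized exactly when Γ ⊢ φ.
module Submission where

open import Defs
open import Level using (Level; _⊔_)
open import Function.Bundles using (_⇔_; mk⇔)
open import Data.List using ([]; _∷_; _++_)
open import Data.List.Membership.Propositional using (_∈_)
open import Data.List.Relation.Binary.Subset.Propositional using (_⊆_)
open import Data.List.Relation.Binary.Subset.Propositional.Properties using (xs⊆xs++ys; xs⊆ys++xs)
open import Data.List.Relation.Unary.All using (All; []; _∷_; lookup)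
open import Data.List.Relation.Unary.Any using (here)
open import Data.Product using (_×_; _,_; proj₁; proj₂)
open import Data.Sum using (_⊎_; inj₁; inj₂)
open import Data.Unit.Polymorphic using () renaming (⊤ to Unit)
open import Relation.Binary.PropositionalEquality using (_≡_; refl; sym; cong; cong₂; subst)
open import Relation.Binary.PropositionalEquality.Properties using (module ≡-Reasoning)

module PBotWProperties {a ℓ : Level} {At : Set a} (Γ : PBotW.Infon At → Set ℓ) where
  open PBotW At

  Step-mono : ∀ {ps qs φ} → ps ⊆ qs → Step Γ ps φ → Step Γ qs φ
  Step-mono ps⊆qs (hyp γ)   = hyp γ
  Step-mono ps⊆qs top       = top
  Step-mono ps⊆qs (∧i p q)  = ∧i (ps⊆qs p) (ps⊆qs q)
  Step-mono ps⊆qs (∧e₁ p)   = ∧e₁ (ps⊆qs p)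
  Step-mono ps⊆qs (∧e₂ p)   = ∧e₂ (ps⊆qs p)
  Step-mono ps⊆qs (⇒i p)    = ⇒i (ps⊆qs p)
  Step-mono ps⊆qs (⇒e p q)  = ⇒e (ps⊆qs p) (ps⊆qs q)
  Step-mono ps⊆qs (⊥w p q)  = ⊥w (ps⊆qs p) (ps⊆qs q)

  Valid-++ : ∀ {ps qs} → Valid Γ ps → Valid Γ qs → Valid Γ (ps ++ qs)
  Valid-++ []                             w = w
  Valid-++ {qs = qs} (_∷_ {ps = ps} s v) w = Step-mono (xs⊆xs++ys ps qs) s ∷ Valid-++ v w

  ⊢-hyp : ∀ {φ} → Γ φ → Γ ⊢ φ
  ⊢-hyp γ = [] , hyp γ ∷ []

  ⊢-top : Γ ⊢ ⊤
  ⊢-top = [] , top ∷ []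

  ⊢-rule₁ : ∀ {φ χ} → Γ ⊢ φ → (∀ {ps} → φ ∈ ps → Step Γ ps χ) → Γ ⊢ χ
  ⊢-rule₁ (ps , v) rule = _ ∷ ps , rule (here refl) ∷ v

  ⊢-rule₂ : ∀ {φ ψ χ} → Γ ⊢ φ → Γ ⊢ ψ → (∀ {ps} → φ ∈ ps → ψ ∈ ps → Step Γ ps χ) → Γ ⊢ χ
  ⊢-rule₂ {φ} {ψ} (ps , v) (qs , w) rule =
    (φ ∷ ps) ++ (ψ ∷ qs) ,
    rule (xs⊆xs++ys (φ ∷ ps) (ψ ∷ qs) (here refl)) (xs⊆ys++xs (ψ ∷ qs) (φ ∷ ps) (here refl))
    ∷ Valid-++ v w

module PVeeProperties {a ℓ : Level} {At : Set a} (Δ : PVee.Formula At → Set ℓ) where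
  open PVee At

  Step-mono : ∀ {ps qs φ} → ps ⊆ qs → Step Δ ps φ → Step Δ qs φ
  Step-mono ps⊆qs (hyp δ)   = hyp δ
  Step-mono ps⊆qs top       = top
  Step-mono ps⊆qs (∧i p q)  = ∧i (ps⊆qs p) (ps⊆qs q)
  Step-mono ps⊆qs (∧e₁ p)   = ∧e₁ (ps⊆qs p)
  Step-mono ps⊆qs (∧e₂ p)   = ∧e₂ (ps⊆qs p)
  Step-mono ps⊆qs (⇒i p)    = ⇒i (ps⊆qs p)
  Step-mono ps⊆qs (⇒e p q)  = ⇒e (ps⊆qs p) (ps⊆qs q)
  Step-mono ps⊆qs (∨i₁ p)   = ∨i₁ (ps⊆qs p)
  Step-mono ps⊆qs (∨i₂ p)   = ∨i₂ (ps⊆qs p)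

  Valid-++ : ∀ {ps qs} → Valid Δ ps → Valid Δ qs → Valid Δ (ps ++ qs)
  Valid-++ []                             w = w
  Valid-++ {qs = qs} (_∷_ {ps = ps} s v) w = Step-mono (xs⊆xs++ys ps qs) s ∷ Valid-++ v w

  ⊢-hyp : ∀ {φ} → Δ φ → Δ ⊢ φ
  ⊢-hyp δ = [] , hyp δ ∷ []

  ⊢-top : Δ ⊢ ⊤
  ⊢-top = [] , top ∷ []

  ⊢-rule₁ : ∀ {φ χ} → Δ ⊢ φ → (∀ {ps} → φ ∈ ps → Step Δ ps χ) → Δ ⊢ χ
  ⊢-rule₁ (ps , v) rule = _ ∷ ps , rule (here refl) ∷ v

  ⊢-rule₂ : ∀ {φ ψ χ} → Δ ⊢ φ → Δ ⊢ ψ → (∀ {ps} → φ ∈ ps → ψ ∈ ps → Step Δ ps χ) → Δ ⊢ χ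
  ⊢-rule₂ {φ} {ψ} (ps , v) (qs , w) rule =
    (φ ∷ ps) ++ (ψ ∷ qs) ,
    rule (xs⊆xs++ys (φ ∷ ps) (ψ ∷ qs) (here refl)) (xs⊆ys++xs (ψ ∷ qs) (φ ∷ ps) (here refl))
    ∷ Valid-++ v w

module TranslationProperties {a : Level} (At : Set a) where
  open PBotW At
  open PVee At using (Formula; _∨⁺_)
    renaming (⊤ to ⊤⁺; ⊥ to ⊥⁺; atom to atom⁺; _∧_ to _∧⁺_; _⇒_ to _⇒⁺_)
  open Translation At

  -- Values outside the image of _* are junk.
  untranslate : Formula → Infon
  untranslate ⊤⁺              = ⊤
  untranslate ⊥⁺              = ⊥
  untranslate (atom⁺ q)       = atom q
  untranslate (χ ∧⁺ ξ)        = untranslate χ ∧ untranslate ξ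
  untranslate ((_ ∨⁺ χ) ⇒⁺ ξ) = untranslate χ ⇒ untranslate ξ
  untranslate (_ ⇒⁺ ξ)        = untranslate ξ
  untranslate (_ ∨⁺ _)        = ⊤

  untranslate-* : ∀ φ → untranslate (φ *) ≡ φ
  untranslate-* ⊤        = refl
  untranslate-* ⊥        = refl
  untranslate-* (atom q) = refl
  untranslate-* (φ ∧ ψ)  = cong₂ _∧_ (untranslate-* φ) (untranslate-* ψ)
  untranslate-* (φ ⇒ ψ)  = cong₂ _⇒_ (untranslate-* φ) (untranslate-* ψ)

  *-injective : ∀ {φ ψ} → φ * ≡ ψ * → φ ≡ ψ
  *-injective {φ} {ψ} eq = begin
    φ                  ≡⟨ sym (untranslate-* φ) ⟩
    untranslate (φ *)  ≡⟨ cong untranslate eq ⟩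
    untranslate (ψ *)  ≡⟨ untranslate-* ψ ⟩
    ψ                  ∎
    where open ≡-Reasoning

module TranslationSoundness {a ℓ : Level} (At : Set a) (Γ : PBotW.Infon At → Set ℓ) where
  open PBotW At
  module V = PVee At
  open Translation At
  open PVeeProperties (Γ *ˢ)

  translate-step : ∀ {ps φ} → Step Γ ps φ → All (λ ψ → (Γ *ˢ) V.⊢ (ψ *)) ps → (Γ *ˢ) V.⊢ (φ *)
  translate-step (hyp γ)  ds = ⊢-hyp (_ , γ , refl)
  translate-step top      ds = ⊢-top
  translate-step (∧i p q) ds = ⊢-rule₂ (lookup ds p) (lookup ds q) V.∧i
  translate-step (∧e₁ p)  ds = ⊢-rule₁ (lookup ds p) V.∧e₁
  translate-step (∧e₂ p)  ds = ⊢-rule₁ (lookup ds p) V.∧e₂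
  translate-step (⇒i p)   ds = ⊢-rule₁ (lookup ds p) V.⇒i
  translate-step (⇒e p q) ds = ⊢-rule₂ (⊢-rule₁ (lookup ds p) V.∨i₂) (lookup ds q) V.⇒e
  translate-step (⊥w p q) ds = ⊢-rule₂ (⊢-rule₁ (lookup ds p) V.∨i₁) (lookup ds q) V.⇒e

  translate-valid : ∀ {ps} → Valid Γ ps → All (λ ψ → (Γ *ˢ) V.⊢ (ψ *)) ps
  translate-valid []      = []
  translate-valid (s ∷ v) = translate-step s ds ∷ ds
    where ds = translate-valid v

  translate-⊢ : ∀ {φ} → Γ ⊢ φ → (Γ *ˢ) V.⊢ (φ *)
  translate-⊢ (_ , v) = lookup (translate-valid v) (here refl)

module Realizability {a ℓ : Level} (At : Set a) (Γ : PBotW.Infon At → Set ℓ) where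
  open PBotW At
  module V = PVee At
  open V using (Formula; _∨⁺_)
    renaming (⊤ to ⊤⁺; ⊥ to ⊥⁺; atom to atom⁺; _∧_ to _∧⁺_; _⇒_ to _⇒⁺_)
  open Translation At
  open TranslationProperties At using (*-injective)
  open PBotWProperties Γ

  PreimageDerivable : Formula → Set (a ⊔ ℓ)
  PreimageDerivable χ = ∀ ψ → ψ * ≡ χ → Γ ⊢ ψ

  ⟦_⟧ : Formula → Set (a ⊔ ℓ)
  ⟦ ⊤⁺ ⟧      = Unit
  ⟦ ⊥⁺ ⟧      = Γ ⊢ ⊥
  ⟦ atom⁺ q ⟧ = Γ ⊢ atom q
  ⟦ χ ∧⁺ ξ ⟧  = ⟦ χ ⟧ × ⟦ ξ ⟧
  ⟦ χ ∨⁺ ξ ⟧  = ⟦ χ ⟧ ⊎ ⟦ ξ ⟧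
  ⟦ χ ⇒⁺ ξ ⟧  = (⟦ χ ⟧ → ⟦ ξ ⟧) × PreimageDerivable (χ ⇒⁺ ξ)

  ⊢⇒⟦*⟧ : ∀ φ → Γ ⊢ φ → ⟦ φ * ⟧
  ⟦*⟧⇒⊢ : ∀ φ → ⟦ φ * ⟧ → Γ ⊢ φ

  ⊢⇒⟦*⟧ ⊤        _ = _
  ⊢⇒⟦*⟧ ⊥        d = d
  ⊢⇒⟦*⟧ (atom q) d = d
  ⊢⇒⟦*⟧ (φ ∧ ψ)  d = ⊢⇒⟦*⟧ φ (⊢-rule₁ d ∧e₁) , ⊢⇒⟦*⟧ ψ (⊢-rule₁ d ∧e₂)
  ⊢⇒⟦*⟧ (φ ⇒ ψ)  d = modus-ponens , λ χ eq → subst (Γ ⊢_) (sym (*-injective eq)) d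
    where
    modus-ponens : ⟦ ⊥⁺ ∨⁺ φ * ⟧ → ⟦ ψ * ⟧
    modus-ponens (inj₁ ⊢⊥)  = ⊢⇒⟦*⟧ ψ (⊢-rule₂ ⊢⊥ d ⊥w)
    modus-ponens (inj₂ ⟦φ⟧) = ⊢⇒⟦*⟧ ψ (⊢-rule₂ (⟦*⟧⇒⊢ φ ⟦φ⟧) d ⇒e)

  ⟦*⟧⇒⊢ ⊤        _               = ⊢-top
  ⟦*⟧⇒⊢ ⊥        d               = d
  ⟦*⟧⇒⊢ (atom q) d               = d
  ⟦*⟧⇒⊢ (φ ∧ ψ)  (⟦φ⟧ , ⟦ψ⟧)     = ⊢-rule₂ (⟦*⟧⇒⊢ φ ⟦φ⟧) (⟦*⟧⇒⊢ ψ ⟦ψ⟧) ∧i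
  ⟦*⟧⇒⊢ (φ ⇒ ψ)  (_ , preimage⊢) = preimage⊢ (φ ⇒ ψ) refl

  ⇒i-preimage : ∀ {χ ξ} → ⟦ ξ ⟧ → PreimageDerivable (χ ⇒⁺ ξ)
  ⇒i-preimage {ξ = .(ψ *)} ⟦ψ⟧ (φ ⇒ ψ) refl = ⊢-rule₁ (⟦*⟧⇒⊢ ψ ⟦ψ⟧) ⇒i

  realize-step : ∀ {qs χ} → V.Step (Γ *ˢ) qs χ → All ⟦_⟧ qs → ⟦ χ ⟧
  realize-step (V.hyp (ψ , γ , refl)) rs = ⊢⇒⟦*⟧ ψ (⊢-hyp γ)
  realize-step V.top                  rs = _
  realize-step (V.∧i p q)             rs = lookup rs p , lookup rs q
  realize-step (V.∧e₁ p)              rs = proj₁ (lookup rs p)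
  realize-step (V.∧e₂ p)              rs = proj₂ (lookup rs p)
  realize-step (V.⇒i p)               rs = (λ _ → lookup rs p) , ⇒i-preimage (lookup rs p)
  realize-step (V.⇒e p q)             rs = proj₁ (lookup rs q) (lookup rs p)
  realize-step (V.∨i₁ p)              rs = inj₁ (lookup rs p)
  realize-step (V.∨i₂ p)              rs = inj₂ (lookup rs p)

  realize-valid : ∀ {qs} → V.Valid (Γ *ˢ) qs → All ⟦_⟧ qs
  realize-valid V.[]      = []
  realize-valid (s V.∷ v) = realize-step s rs ∷ rs
    where rs = realize-valid v

  untranslate-⊢ : ∀ {φ} → (Γ *ˢ) V.⊢ (φ *) → Γ ⊢ φ
  untranslate-⊢ {φ} (_ , v) = ⟦*⟧⇒⊢ φ (lookup (realize-valid v) (here refl))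

theorem6 : {a ℓ : Level} (At : Set a) (Γ : PBotW.Infon At → Set ℓ) (φ : PBotW.Infon At) →
           PBotW._⊢_ At Γ φ ⇔ PVee._⊢_ At (Translation._*ˢ At Γ) (Translation._* At φ)
theorem6 At Γ φ = mk⇔ (TranslationSoundness.translate-⊢ At Γ) (Realizability.untranslate-⊢ At Γ)
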